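{- For all integers $m,n\ge 1$, the average number of spotlights in a spotlight tiling of the $m\times n$ rectangle (averaged uniformly over all distinct spotlight tilings of it) equals $$\frac{mn(m+n-1)}{(m+n)(m+n-1)-mn}\left(1+\frac{n-1}{m+1}+\frac{m-1}{n+1}\right).$$
   Context: A region is a finite set of unit squares of the square grid whose edge-adjacency graph is connected. A northwest corner of a region $R$ is a square of $R$ such that neither the square directly above it nor the square directly to its left belongs to $R$. A spotlight tiling of $R$ is produced recursively: choose a northwest corner $s$ of $R$ and place a spotlight with endpoint $s$, extending either east (horizontally) or south (vertically) as far as possible, i.e. consisting of $s$ together with the maximal run of consecutive squares of $R$ in that direction. The uncovered squares form a disjoint union of regions (connected components), each of which is then given a spotlight tiling recursively; the empty region has exactly one (empty) tiling. The spotlight tiling is the final collection of spotlights, a partition of $R$ into segments. Two spotlight tilings are the same if and only if they give the same collection of spotlights (order of placement is irrelevant, and a last-placed spotlight of length $1$ carries no direction). The number of spotlights of a tiling is the number of pieces in this collection. -}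

module Defs where

open import Data.Nat using (ℕ; zero; suc; _+_; _≤_; _≡ᵇ_; _≤ᵇ_; _<ᵇ_)
open import Data.Bool using (Bool; true; false; _∧_; not)
open import Data.Product using (_×_; _,_; Σ)
open import Data.Sum using (_⊎_)
open import Data.List using (List; []; _∷_; _++_)
open import Data.List.Relation.Unary.All using (All)
open import Data.List.Relation.Unary.Any using (Any)
open import Data.List.Relation.Unary.AllPairs using (AllPairs)
open import Relation.Binary.PropositionalEquality using (_≡_)
open import Relation.Nullary using (¬_)

-- A cell (unit square) is (row , column); rows grow downward (south),
-- columns grow rightward (east).
Cell : Set
Cell = ℕ × ℕ

CellSet : Set
CellSet = Cell → Bool

_∈R_ : Cell → CellSet → Set
c ∈R R = R c ≡ true

_∉R_ : Cell → CellSet → Set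
c ∉R R = R c ≡ false

EmptySet : CellSet → Set
EmptySet R = ∀ c → c ∉R R

rect : ℕ → ℕ → CellSet
rect m n (i , j) = (i <ᵇ m) ∧ (j <ᵇ n)

data Dir : Set where
  east south : Dir

step : Dir → Cell → Cell
step east  (i , j) = (i , suc j)
step south (i , j) = (suc i , j)

Adjacent : Cell → Cell → Set
Adjacent c d = Σ Dir (λ dir → step dir c ≡ d ⊎ step dir d ≡ c)

data Path (C : CellSet) : Cell → Cell → Set where
  here : ∀ {c} → c ∈R C → Path C c c
  next : ∀ {c d e} → c ∈R C → Adjacent c d → Path C d e → Path C c e

Connected : CellSet → Set
Connected C = ∀ c d → c ∈R C → d ∈R C → Path C c d

NonEmpty : CellSet → Set
NonEmpty C = Σ Cell (λ c → c ∈R C)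

-- Cs is the list of connected components of R (in some order).
IsComponents : CellSet → List CellSet → Set
IsComponents R Cs =
    All (λ C → NonEmpty C × Connected C) Cs
  × All (λ C → ∀ c → c ∈R C → c ∈R R) Cs
  × (∀ c → c ∈R R → Any (λ C → c ∈R C) Cs)
  × AllPairs (λ C D → ∀ c → ¬ (c ∈R C × c ∈R D)) Cs
  × All (λ C → ∀ c d → c ∈R C → d ∈R R → Adjacent c d → d ∈R C) Cs

-- Northwest corner: in R, and neither the square above nor the square to the
-- left is in R (squares outside the quadrant ℕ × ℕ are never in R).
AboveNotIn : CellSet → Cell → Set
AboveNotIn R (zero  , j) = ⊤' where open import Data.Unit using () renaming (⊤ to ⊤')
AboveNotIn R (suc i , j) = (i , j) ∉R R

LeftNotIn : CellSet → Cell → Set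
LeftNotIn R (i , zero)  = ⊤' where open import Data.Unit using () renaming (⊤ to ⊤')
LeftNotIn R (i , suc j) = (i , j) ∉R R

NWCorner : CellSet → Cell → Set
NWCorner R s = s ∈R R × AboveNotIn R s × LeftNotIn R s

run : Dir → Cell → ℕ → Cell
run dir s zero    = s
run dir s (suc k) = step dir (run dir s k)

MaximalRun : CellSet → Cell → Dir → ℕ → Set
MaximalRun R s dir l = (∀ k → k ≤ l → run dir s k ∈R R) × run dir s (suc l) ∉R R

-- A spotlight, as a set of squares (a segment).  A segment of length 1 has
-- no direction; longer segments are determined by endpoint, direction and length.
data Spotlight : Set where
  single : Cell → Spotlight
  long   : Dir → Cell → ℕ → Spotlight   -- long dir s k : length k + 2

mkSpot : Dir → Cell → ℕ → Spotlight
mkSpot dir s zero    = single s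
mkSpot dir s (suc k) = long dir s k

covers : Dir → Cell → ℕ → Cell → Bool
covers east  (i , j) l (i' , j') = (i' ≡ᵇ i) ∧ ((j ≤ᵇ j') ∧ (j' ≤ᵇ j + l))
covers south (i , j) l (i' , j') = (j' ≡ᵇ j) ∧ ((i ≤ᵇ i') ∧ (i' ≤ᵇ i + l))

remove : CellSet → Dir → Cell → ℕ → CellSet
remove R dir s l c = R c ∧ not (covers dir s l c)

-- Spotlight tilings, following the recursive definition: the empty region has
-- the empty tiling; otherwise choose a northwest corner s, place the maximal
-- spotlight from s east or south, split the rest into connected components and
-- tile each of them recursively.  A tiling is the resulting list of spotlights.
mutual
  data Tiling : CellSet → List Spotlight → Set where
    empty : ∀ {R} → EmptySet R → Tiling R []
    place : ∀ {R s dir l Cs T} →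
            NWCorner R s →
            MaximalRun R s dir l →
            IsComponents (remove R dir s l) Cs →
            Tilings Cs T →
            Tiling R (mkSpot dir s l ∷ T)

  data Tilings : List CellSet → List Spotlight → Set where
    []  : Tilings [] []
    _∷_ : ∀ {C Cs T Ts} → Tiling C T → Tilings Cs Ts → Tilings (C ∷ Cs) (T ++ Ts)

module Submission where

-- A nonempty box (a rectangle placed anywhere in the quadrant) has exactly one
-- northwest corner, its top-left square, and the maximal spotlight placed there
-- is either the whole top row (east) or the whole left column (south).  What
-- remains is again a box, hence connected, hence its own unique component.  So
-- the tilings of an (m+1) × (n+1) box are: the east spotlight followed by a
-- tiling of the m × (n+1) box below it, or the south spotlight followed by a
-- tiling of the (m+1) × n box to its right -- except in the 1 × 1 box, where
-- both spotlights are the same single square.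
--
-- Writing g p q = C(p+q, p) for the number of lattice paths, this recursion
-- gives for the (p+1) × (q+1) box
--   #tilings    + g p q                         = g (p+1) (q+1),
--   #spotlights + (p+q+1) g p q + g (p+2) (q+2) = (p+q+4) g (p+1) (q+1),
-- and the absorption identities  (p+1)(q+1) g (p+1) (q+1) = (p+q+1)(p+q+2) g p q
-- turn these two counts into the ratio stated in the theorem.

open import Defs
open import Data.Nat using (ℕ; zero; suc; _+_; _*_; _∸_; _≤_; _<_; _≤ᵇ_; _<ᵇ_; _≡ᵇ_; z≤n; s≤s; z<s)
open import Data.Nat.Properties
open import Data.Bool using (Bool; true; false; _∧_; not; T)
open import Data.Bool.Properties using (∧-conicalˡ; ∧-conicalʳ; ∧-comm; ∧-zeroʳ; ∧-identityʳ; ¬-not; not-¬; T-≡)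
open import Data.Unit using (tt)
open import Data.Product using (Σ; _×_; _,_; proj₁; proj₂)
open import Data.Sum using (inj₁; inj₂)
open import Data.List using (List; []; _∷_; _++_; map; length)
open import Data.List.Properties using (++-identityʳ; length-++; length-map; map-++)
open import Data.Nat.ListAction using (sum)
open import Data.Nat.ListAction.Properties using (sum-++)
open import Data.List.Relation.Unary.All as All using (All)
import Data.List.Relation.Unary.All.Properties as AllP
open import Data.List.Relation.Unary.Any as Any using (Any; here; there)
open import Data.List.Relation.Unary.Any.Properties using (¬Any[])
open import Data.List.Relation.Unary.AllPairs as AllPairs using (AllPairs)
import Data.List.Relation.Unary.AllPairs.Properties as AllPairsP
open import Data.List.Membership.Propositional using (_∈_; _∉_)
open import Data.List.Membership.Propositional.Properties using (∈-map⁺; ∈-++⁺ˡ; ∈-++⁺ʳ)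
open import Data.List.Relation.Binary.Permutation.Propositional using (_↭_; ↭-reflexive)
open import Data.List.Relation.Binary.Permutation.Propositional.Properties using (∈-resp-↭; drop-mid)
open import Data.Nat.Tactic.RingSolver using (solve)
open import Algebra.Properties.CommutativeSemigroup +-commutativeSemigroup using (interchange; x∙yz≈y∙xz)
open import Function.Bundles using (Equivalence)
open import Relation.Binary.PropositionalEquality
open import Relation.Nullary using (¬_; contradiction)

open ≡-Reasoning

-- Lattice paths with p steps down and q steps right: the binomial
-- coefficient C(p+q, p), built by Pascal's rule.
paths : ℕ → ℕ → ℕ
paths zero    q       = 1
paths (suc p) zero    = 1
paths (suc p) (suc q) = paths p (suc q) + paths (suc p) q

paths-sym : ∀ p q → paths p q ≡ paths q p
paths-sym zero    zero    = refl
paths-sym zero    (suc q) = refl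
paths-sym (suc p) zero    = refl
paths-sym (suc p) (suc q) =
  trans (cong₂ _+_ (paths-sym p (suc q)) (paths-sym (suc p) q)) (+-comm (paths (suc q) p) _)

paths-row : ∀ q → paths 1 q ≡ suc q
paths-row zero    = refl
paths-row (suc q) = cong suc (paths-row q)

paths-column : ∀ p → paths p 1 ≡ suc p
paths-column p = trans (paths-sym p 1) (paths-row p)

paths-zero : ∀ p → paths p 0 ≡ 1
paths-zero p = paths-sym p 0

absorption : ∀ p q → suc p * paths (suc p) q ≡ suc (p + q) * paths p q
                   × suc q * paths p (suc q) ≡ suc (p + q) * paths p q
absorption zero    q    =
  trans (*-identityˡ (paths 1 q)) (trans (paths-row q) (sym (*-identityʳ (suc q)))) , refl
absorption (suc p) zero =
  trans (*-identityʳ (2 + p)) two+p ,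
  trans (*-identityˡ (paths (suc p) 1)) (trans (paths-column (suc p)) two+p)
  where
  two+p : 2 + p ≡ suc (suc p + 0) * 1
  two+p = solve (p ∷ [])
absorption (suc p) (suc q) = down , right
  where
  G = paths (suc p) (suc q)
  down : (2 + p) * (G + paths (2 + p) q) ≡ suc (suc p + suc q) * G
  down = begin
    (2 + p) * (G + paths (2 + p) q)
      ≡⟨ *-distribˡ-+ (2 + p) G _ ⟩
    (2 + p) * G + (2 + p) * paths (2 + p) q
      ≡⟨ cong ((2 + p) * G +_) (proj₁ (absorption (suc p) q)) ⟩
    (2 + p) * G + suc (suc p + q) * paths (suc p) q
      ≡⟨ cong ((2 + p) * G +_) (proj₂ (absorption (suc p) q)) ⟨
    (2 + p) * G + suc q * G
      ≡⟨ *-distribʳ-+ G (2 + p) (suc q) ⟨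
    suc (suc p + suc q) * G ∎
  right : (2 + q) * (paths p (2 + q) + G) ≡ suc (suc p + suc q) * G
  right = begin
    (2 + q) * (paths p (2 + q) + G)
      ≡⟨ *-distribˡ-+ (2 + q) (paths p (2 + q)) G ⟩
    (2 + q) * paths p (2 + q) + (2 + q) * G
      ≡⟨ cong (_+ (2 + q) * G) (proj₂ (absorption p (suc q))) ⟩
    suc (p + suc q) * paths p (suc q) + (2 + q) * G
      ≡⟨ cong (_+ (2 + q) * G) (proj₁ (absorption p (suc q))) ⟨
    suc p * G + (2 + q) * G
      ≡⟨ *-distribʳ-+ G (suc p) (2 + q) ⟨
    (suc p + (2 + q)) * G
      ≡⟨ cong (λ k → suc k * G) (+-suc p (suc q)) ⟩
    suc (suc p + suc q) * G ∎

paths-diagonal : ∀ p q →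
  suc p * suc q * paths (suc p) (suc q) ≡ suc (p + q) * (2 + p + q) * paths p q
paths-diagonal p q =
  combine (paths (suc p) (suc q)) (paths (suc p) q) (paths p q)
          (proj₂ (absorption (suc p) q)) (proj₁ (absorption p q))
  where
  combine : ∀ G v g → suc q * G ≡ suc (suc p + q) * v → suc p * v ≡ suc (p + q) * g →
            suc p * suc q * G ≡ suc (p + q) * (2 + p + q) * g
  combine G v g hG hv = begin
    suc p * suc q * G                   ≡⟨ *-assoc (suc p) (suc q) G ⟩
    suc p * (suc q * G)                 ≡⟨ cong (suc p *_) hG ⟩
    suc p * (suc (suc p + q) * v)       ≡⟨ solve (p ∷ q ∷ v ∷ []) ⟩
    suc (suc p + q) * (suc p * v)       ≡⟨ cong (suc (suc p + q) *_) hv ⟩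
    suc (suc p + q) * (suc (p + q) * g) ≡⟨ solve (p ∷ q ∷ g ∷ []) ⟩
    suc (p + q) * (2 + p + q) * g       ∎

-- The arithmetic of one step of the spotlight count (see 'count-spotlights'
-- below): at the top row, at the left column and in the interior of the (p, q)
-- grid.  The hypotheses are the counts for the smaller boxes and the boundary
-- values of 'paths'; the shapes of the terms are those produced by unfolding
-- 'paths' and the list of tilings.
spotlights-row-step : ∀ q L S x y → x ≡ 2 + q →
  L + 1 ≡ x → S + ((1 + q) * 1 + y) ≡ (4 + q) * x →
  ((1 + 0) + (L + S)) + ((2 + q) * 1 + ((1 + (1 + x)) + y)) ≡ (5 + q) * (1 + x)
spotlights-row-step q L S _ y refl hL hS = begin
  ((1 + 0) + (L + S)) + ((2 + q) * 1 + ((1 + (1 + (2 + q))) + y))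
    ≡⟨ solve (q ∷ L ∷ S ∷ y ∷ []) ⟩
  ((L + 1) + (S + ((1 + q) * 1 + y))) + (5 + q)
    ≡⟨ cong₂ (λ u v → (u + v) + (5 + q)) hL hS ⟩
  ((2 + q) + (4 + q) * (2 + q)) + (5 + q)
    ≡⟨ solve (q ∷ []) ⟩
  (5 + q) * (1 + (2 + q)) ∎

spotlights-column-step : ∀ p L S x y z → z ≡ 1 → x ≡ 2 + p →
  L + z ≡ x → S + ((1 + p + 0) * z + y) ≡ (4 + p + 0) * x →
  ((L + S) + (1 + 0)) + ((2 + p + 0) * 1 + (y + ((x + 1) + 1))) ≡ (5 + p + 0) * (x + 1)
spotlights-column-step p L S _ y _ refl refl hL hS = begin
  ((L + S) + (1 + 0)) + ((2 + p + 0) * 1 + (y + (((2 + p) + 1) + 1)))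
    ≡⟨ solve (p ∷ L ∷ S ∷ y ∷ []) ⟩
  ((L + 1) + (S + ((1 + p + 0) * 1 + y))) + (5 + p)
    ≡⟨ cong₂ (λ u v → (u + v) + (5 + p)) hL hS ⟩
  ((2 + p) + (4 + p + 0) * (2 + p)) + (5 + p)
    ≡⟨ solve (p ∷ []) ⟩
  (5 + p + 0) * ((2 + p) + 1) ∎

spotlights-interior-step : ∀ p q L₁ S₁ L₂ S₂ u v U V Y Z →
  L₁ + u ≡ U → S₁ + (suc (p + suc q) * u + Y) ≡ (4 + p + suc q) * U →
  L₂ + v ≡ V → S₂ + (suc (suc p + q) * v + Z) ≡ (4 + suc p + q) * V →
  ((L₁ + S₁) + (L₂ + S₂)) + (suc (suc p + suc q) * (u + v) + (Y + Z))
    ≡ (4 + suc p + suc q) * (U + V)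
spotlights-interior-step p q L₁ S₁ L₂ S₂ u v U V Y Z hL₁ hS₁ hL₂ hS₂ = begin
  ((L₁ + S₁) + (L₂ + S₂)) + (suc (suc p + suc q) * (u + v) + (Y + Z))
    ≡⟨ solve (p ∷ q ∷ L₁ ∷ S₁ ∷ L₂ ∷ S₂ ∷ u ∷ v ∷ Y ∷ Z ∷ []) ⟩
  ((L₁ + u) + (S₁ + (suc (p + suc q) * u + Y))) + ((L₂ + v) + (S₂ + (suc (suc p + q) * v + Z)))
    ≡⟨ cong₂ _+_ (cong₂ _+_ hL₁ hS₁) (cong₂ _+_ hL₂ hS₂) ⟩
  (U + (4 + p + suc q) * U) + (V + (4 + suc p + q) * V)
    ≡⟨ solve (p ∷ q ∷ U ∷ V ∷ []) ⟩
  (4 + suc p + suc q) * (U + V) ∎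

-- For m = p+1 and n = q+1, the two polynomials of the theorem: the
-- denominator (m+n)(m+n−1) − mn, and (m+1)(n+1) times the bracket
-- 1 + (n−1)/(m+1) + (m−1)/(n+1).
denominator : ℕ → ℕ → ℕ
denominator p q = (suc p + suc q) * (p + suc q) ∸ suc p * suc q

bracket : ℕ → ℕ → ℕ
bracket p q = (suc p + 1) * (suc q + 1) + q * (suc q + 1) + p * (suc p + 1)

tilings-ratio : ∀ p q L g G →
  L + g ≡ G → suc p * suc q * G ≡ suc (p + q) * (2 + p + q) * g →
  suc p * suc q * L ≡ denominator p q * g
tilings-ratio p q L g G hL hG = +-cancelʳ-≡ (k * g) (k * L) (denominator p q * g) (begin
  k * L + k * g                       ≡⟨ *-distribˡ-+ k L g ⟨
  k * (L + g)                         ≡⟨ cong (k *_) hL ⟩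
  k * G                               ≡⟨ hG ⟩
  suc (p + q) * (2 + p + q) * g       ≡⟨ solve (p ∷ q ∷ g ∷ []) ⟩
  (suc p + suc q) * (p + suc q) * g   ≡⟨ cong (_* g) (m∸n+n≡m k≤N) ⟨
  (denominator p q + k) * g           ≡⟨ *-distribʳ-+ g (denominator p q) k ⟩
  denominator p q * g + k * g         ∎)
  where
  k = suc p * suc q
  k≤N : k ≤ (suc p + suc q) * (p + suc q)
  k≤N = *-mono-≤ (m≤m+n (suc p) (suc q)) (m≤n+m (suc q) p)

spotlights-ratio : ∀ p q S g G G₂ → S + (suc (p + q) * g + G₂) ≡ (4 + p + q) * G →
  suc p * suc q * G ≡ suc (p + q) * (2 + p + q) * g →
  (2 + p) * (2 + q) * G₂ ≡ suc (suc p + suc q) * (2 + suc p + suc q) * G →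
  (2 + p) * (2 + q) * S ≡ suc (p + q) * bracket p q * g
spotlights-ratio p q S g G G₂ hS hG hG₂ = +-cancelʳ-≡ W _ _ (begin
  (2 + p) * (2 + q) * S + W
    ≡⟨ *-distribˡ-+ ((2 + p) * (2 + q)) S _ ⟨
  (2 + p) * (2 + q) * (S + (suc (p + q) * g + G₂))
    ≡⟨ cong ((2 + p) * (2 + q) *_) hS ⟩
  (2 + p) * (2 + q) * ((4 + p + q) * G)
    ≡⟨ solve (p ∷ q ∷ G ∷ []) ⟩
  (4 + p + q) * (suc p * suc q * G) + suc (suc p + suc q) * (2 + suc p + suc q) * G
    ≡⟨ cong₂ _+_ (cong ((4 + p + q) *_) hG) (sym hG₂) ⟩
  (4 + p + q) * (suc (p + q) * (2 + p + q) * g) + (2 + p) * (2 + q) * G₂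
    ≡⟨ solve (p ∷ q ∷ g ∷ G₂ ∷ []) ⟩
  suc (p + q) * ((suc p + 1) * (suc q + 1) + q * (suc q + 1) + p * (suc p + 1)) * g
    + (2 + p) * (2 + q) * (suc (p + q) * g + G₂) ∎)
  where
  W = (2 + p) * (2 + q) * (suc (p + q) * g + G₂)

average-identity : ∀ p q L S g d e →
  suc p * suc q * L ≡ d * g → (2 + p) * (2 + q) * S ≡ suc (p + q) * e * g →
  S * (d * ((suc p + 1) * (suc q + 1))) ≡ L * ((suc p * suc q * (p + suc q)) * e)
average-identity p q L S g d e hL hS = begin
  S * (d * ((suc p + 1) * (suc q + 1)))    ≡⟨ solve (p ∷ q ∷ S ∷ d ∷ []) ⟩
  d * ((2 + p) * (2 + q) * S)              ≡⟨ cong (d *_) hS ⟩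
  d * (suc (p + q) * e * g)                ≡⟨ solve (p ∷ q ∷ g ∷ d ∷ e ∷ []) ⟩
  (d * g) * (suc (p + q) * e)              ≡⟨ cong (_* (suc (p + q) * e)) hL ⟨
  (suc p * suc q * L) * (suc (p + q) * e)  ≡⟨ solve (p ∷ q ∷ L ∷ e ∷ []) ⟩
  L * ((suc p * suc q * (p + suc q)) * e)  ∎

-- The constructors of All and AllPairs are brought into scope only now: the
-- variable lists handed to the ring solver above are written with the list
-- constructors, and overloading them makes the solver's elaboration very slow.
open import Data.List.Relation.Unary.All using ([]; _∷_)
open import Data.List.Relation.Unary.AllPairs using ([]; _∷_)

_⊆R_ : CellSet → CellSet → Set
C ⊆R Q = ∀ c → c ∈R C → c ∈R Q

ClosedIn : CellSet → CellSet → Set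
ClosedIn C Q = ∀ c d → c ∈R C → d ∈R Q → Adjacent c d → d ∈R C

∧-intro : ∀ {x y} → x ≡ true → y ≡ true → x ∧ y ≡ true
∧-intro = cong₂ _∧_

module _ {R Q : CellSet} (R≗Q : R ≗ Q) where

  ∈-resp : ∀ {c} → c ∈R R → c ∈R Q
  ∈-resp {c} = trans (sym (R≗Q c))

  ∉-resp : ∀ {c} → c ∉R R → c ∉R Q
  ∉-resp {c} = trans (sym (R≗Q c))

⊆-antisym : ∀ {R Q} → R ⊆R Q → Q ⊆R R → R ≗ Q
⊆-antisym {R} {Q} R⊆Q Q⊆R c with R c in eqR | Q c in eqQ
... | true  | true  = refl
... | false | false = refl
... | true  | false = contradiction (R⊆Q c eqR) (not-¬ eqQ)
... | false | true  = contradiction (Q⊆R c eqQ) (not-¬ eqR)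

remove-⊆ : ∀ R dir s l → remove R dir s l ⊆R R
remove-⊆ R dir s l c = ∧-conicalˡ (R c) _

remove-resp : ∀ {R Q} → R ≗ Q → ∀ dir s l → remove R dir s l ≗ remove Q dir s l
remove-resp R≗Q dir s l c = cong (_∧ not (covers dir s l c)) (R≗Q c)

-- Every notion entering the definition of a tiling respects extensional
-- equality of cell sets, hence so do tilings.  This lets us work with boxes
-- instead of sets that merely have the same members as a box.
≗-sym : ∀ {R Q : CellSet} → R ≗ Q → Q ≗ R
≗-sym R≗Q c = sym (R≗Q c)

NWCorner-resp : ∀ {R Q s} → R ≗ Q → NWCorner R s → NWCorner Q s
NWCorner-resp {R} {Q} {i , j} R≗Q (s∈R , above , left) =
  ∈-resp R≗Q s∈R , above′ i above , left′ j left
  where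
  above′ : ∀ i → AboveNotIn R (i , j) → AboveNotIn Q (i , j)
  above′ zero    _ = tt
  above′ (suc i) h = ∉-resp R≗Q h
  left′ : ∀ j → LeftNotIn R (i , j) → LeftNotIn Q (i , j)
  left′ zero    _ = tt
  left′ (suc j) h = ∉-resp R≗Q h

MaximalRun-resp : ∀ {R Q s dir l} → R ≗ Q → MaximalRun R s dir l → MaximalRun Q s dir l
MaximalRun-resp R≗Q (inside , beyond) = (λ k k≤l → ∈-resp R≗Q (inside k k≤l)) , ∉-resp R≗Q beyond

IsComponents-resp : ∀ {R Q Cs} → R ≗ Q → IsComponents R Cs → IsComponents Q Cs
IsComponents-resp R≗Q (pieces , ⊆R , cover , disjoint , closed) =
    pieces
  , All.map (λ C⊆R c c∈C → ∈-resp R≗Q (C⊆R c c∈C)) ⊆R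
  , (λ c c∈Q → cover c (∈-resp (≗-sym R≗Q) c∈Q))
  , disjoint
  , All.map (λ C-closed c d c∈C d∈Q → C-closed c d c∈C (∈-resp (≗-sym R≗Q) d∈Q)) closed

Tiling-resp : ∀ {R Q T} → R ≗ Q → Tiling R T → Tiling Q T
Tiling-resp R≗Q (empty R-empty) = empty (λ c → ∉-resp R≗Q (R-empty c))
Tiling-resp R≗Q (place {s = s} {dir} {l} nw run cs ts) =
  place (NWCorner-resp R≗Q nw) (MaximalRun-resp R≗Q run)
        (IsComponents-resp (remove-resp R≗Q dir s l) cs) ts

adjacent-sym : ∀ {c d} → Adjacent c d → Adjacent d c
adjacent-sym (dir , inj₁ e) = dir , inj₂ e
adjacent-sym (dir , inj₂ e) = dir , inj₁ e

path-start : ∀ {C c d} → Path C c d → c ∈R C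
path-start (here c∈C)     = c∈C
path-start (next c∈C _ _) = c∈C

path-++ : ∀ {C c d e} → Path C c d → Path C d e → Path C c e
path-++ (here _)          q = q
path-++ (next c∈C adj p) q = next c∈C adj (path-++ p q)

path-reverse : ∀ {C c d} → Path C c d → Path C d c
path-reverse (here c∈C)       = here c∈C
path-reverse (next c∈C adj p) =
  path-++ (path-reverse p) (next (path-start p) (adjacent-sym adj) (here c∈C))

closed-reach : ∀ {C Q c d} → ClosedIn C Q → c ∈R C → Path Q c d → d ∈R C
closed-reach closed c∈C (here _)       = c∈C
closed-reach closed c∈C (next _ adj p) =
  closed-reach closed (closed _ _ c∈C (path-start p) adj) p

closed-covers : ∀ {C Q} → Connected Q → NonEmpty C → C ⊆R Q → ClosedIn C Q → Q ⊆R C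
closed-covers conn (c , c∈C) C⊆Q closed d d∈Q =
  closed-reach closed c∈C (conn c d (C⊆Q c c∈C) d∈Q)

tiling-of-empty : ∀ {R T} → EmptySet R → Tiling R T → T ≡ []
tiling-of-empty _       (empty _)                = refl
tiling-of-empty R-empty (place (s∈R , _) _ _ _) = contradiction s∈R (not-¬ (R-empty _))

-- A connected set is its own (unique) component, so tiling its list of
-- components is the same as tiling the set itself.
tiling-from-components : ∀ {Q Cs T} → Connected Q → IsComponents Q Cs → Tilings Cs T → Tiling Q T
tiling-from-components conn (_ , _ , cover , _ , _) [] =
  empty (λ c → ¬-not (λ c∈Q → ¬Any[] (cover c c∈Q)))
tiling-from-components {Q} conn (((neC , _) ∷ []) , (C⊆Q ∷ []) , _ , _ , (closedC ∷ [])) (t ∷ []) =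
  subst (Tiling Q) (sym (++-identityʳ _))
        (Tiling-resp (⊆-antisym C⊆Q (closed-covers conn neC C⊆Q closedC)) t)
tiling-from-components conn
  ((neC , _) ∷ ((d , d∈D) , _) ∷ _ , C⊆Q ∷ D⊆Q ∷ _ , _ , (C∩D ∷ _) ∷ _ , closedC ∷ _) _ =
  contradiction (closed-covers conn neC C⊆Q closedC d (D⊆Q d d∈D) , d∈D) (C∩D d)

components-from-tiling : ∀ {Q T} → Connected Q → Tiling Q T →
                         Σ (List CellSet) (λ Cs → IsComponents Q Cs × Tilings Cs T)
components-from-tiling conn (empty Q-empty) =
  [] , ([] , [] , (λ c c∈Q → contradiction c∈Q (not-¬ (Q-empty c))) , [] , []) , []
components-from-tiling {Q} {T} conn t@(place (s∈Q , _) _ _ _) =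
  Q ∷ [] ,
  ((((_ , s∈Q) , conn) ∷ []) , ((λ _ c∈Q → c∈Q) ∷ []) , (λ _ c∈Q → here c∈Q) , ([] ∷ [])
    , ((λ _ _ _ d∈Q _ → d∈Q) ∷ [])) ,
  subst (Tilings _) (++-identityʳ T) (t ∷ [])

place-onto : ∀ R s dir l {Q T} → NWCorner R s → MaximalRun R s dir l →
             remove R dir s l ≗ Q → Connected Q → Tiling Q T → Tiling R (mkSpot dir s l ∷ T)
place-onto R s dir l nw run rest≗Q conn t =
  let Cs , cs , ts = components-from-tiling conn t
  in  place nw run (IsComponents-resp (≗-sym rest≗Q) cs) ts

remainder-tiling : ∀ R s dir l {Q Cs T} → remove R dir s l ≗ Q → Connected Q →
                   IsComponents (remove R dir s l) Cs → Tilings Cs T → Tiling Q T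
remainder-tiling R s dir l rest≗Q conn cs ts =
  tiling-from-components conn (IsComponents-resp rest≗Q cs) ts

maximal-run-unique : ∀ R s dir {l l′} → MaximalRun R s dir l → MaximalRun R s dir l′ → l ≡ l′
maximal-run-unique R s dir (inside , beyond) (inside′ , beyond′) =
  ≤-antisym (≮⇒≥ (λ l′<l → not-¬ beyond′ (inside _ l′<l)))
            (≮⇒≥ (λ l<l′ → not-¬ beyond (inside′ _ l<l′)))

endpoint : Spotlight → Cell
endpoint (single c)   = c
endpoint (long _ c _) = c

endpoint-mkSpot : ∀ dir s l → endpoint (mkSpot dir s l) ≡ s
endpoint-mkSpot dir s zero    = refl
endpoint-mkSpot dir s (suc l) = refl

mutual
  endpoints-inside : ∀ {R T} → Tiling R T → All (λ x → endpoint x ∈R R) T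
  endpoints-inside (empty _) = []
  endpoints-inside {R} (place {s = s} {dir} {l} (s∈R , _) _ (_ , Cs⊆ , _) ts) =
    subst (_∈R R) (sym (endpoint-mkSpot dir s l)) s∈R
    ∷ endpoints-inside* ts (All.map (λ C⊆ c c∈C → remove-⊆ R dir s l c (C⊆ c c∈C)) Cs⊆)

  endpoints-inside* : ∀ {R Cs T} → Tilings Cs T → All (_⊆R R) Cs → All (λ x → endpoint x ∈R R) T
  endpoints-inside* []       []           = []
  endpoints-inside* (t ∷ ts) (C⊆R ∷ Cs⊆R) =
    AllP.++⁺ (All.map (C⊆R _) (endpoints-inside t)) (endpoints-inside* ts Cs⊆R)

inRange : ℕ → ℕ → ℕ → Bool
inRange a m i = (a ≤ᵇ i) ∧ (i <ᵇ a + m)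

T⇒true : ∀ {x} → T x → x ≡ true
T⇒true = Equivalence.to T-≡

true⇒T : ∀ {x} → x ≡ true → T x
true⇒T = Equivalence.from T-≡

inRange-sound : ∀ a m i → inRange a m i ≡ true → a ≤ i × i < a + m
inRange-sound a m i h =
  ≤ᵇ⇒≤ a i (true⇒T (∧-conicalˡ _ _ h)) , <ᵇ⇒< i (a + m) (true⇒T (∧-conicalʳ _ _ h))

inRange-complete : ∀ {a m i} → a ≤ i → i < a + m → inRange a m i ≡ true
inRange-complete a≤i i<a+m = ∧-intro (T⇒true (≤⇒≤ᵇ a≤i)) (T⇒true (<⇒<ᵇ i<a+m))

empty-range : ∀ a i → inRange a 0 i ≡ false
empty-range a i = ¬-not λ h →
  let a≤i , i<a+0 = inRange-sound a 0 i h
  in  <-irrefl refl (≤-<-trans a≤i (subst (i <_) (+-identityʳ a) i<a+0))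

range-start : ∀ a m → inRange a (suc m) a ≡ true
range-start a m = inRange-complete ≤-refl (m<m+n a z<s)

range-end : ∀ a m → inRange a m (a + m) ≡ false
range-end a m = ¬-not (λ h → <-irrefl refl (proj₂ (inRange-sound a m (a + m) h)))

<ᵇ-irrefl : ∀ a → (a <ᵇ a) ≡ false
<ᵇ-irrefl zero    = refl
<ᵇ-irrefl (suc a) = <ᵇ-irrefl a

range-before : ∀ a m → inRange (suc a) m a ≡ false
range-before a m = cong (_∧ (a <ᵇ suc a + m)) (<ᵇ-irrefl a)

range-first : ∀ {a m} i → inRange a m i ≡ true →
              (∀ {i′} → i ≡ suc i′ → inRange a m i′ ≡ false) → i ≡ a
range-first {a} {m} zero    h _      = sym (n≤0⇒n≡0 (proj₁ (inRange-sound a m 0 h)))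
range-first {a} {m} (suc i) h before =
  let a≤1+i , 1+i<a+m = inRange-sound a m (suc i) h
      i-outside = λ a≤i → not-¬ (before refl) (inRange-complete a≤i (<-trans (n<1+n i) 1+i<a+m))
  in  ≤-antisym (≰⇒> i-outside) a≤1+i

≤ᵇ-as-<ᵇ : ∀ i n → (i ≤ᵇ n) ≡ (i <ᵇ suc n)
≤ᵇ-as-<ᵇ zero    n = refl
≤ᵇ-as-<ᵇ (suc i) n = refl

interval-as-range : ∀ b l j → (b ≤ᵇ j) ∧ (j ≤ᵇ b + l) ≡ inRange b (suc l) j
interval-as-range b l j =
  cong ((b ≤ᵇ j) ∧_) (trans (≤ᵇ-as-<ᵇ j (b + l)) (cong (j <ᵇ_) (sym (+-suc b l))))

<ᵇ-as-≤ᵇ∧≢ : ∀ a i → (a <ᵇ i) ≡ (a ≤ᵇ i) ∧ not (i ≡ᵇ a)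
<ᵇ-as-≤ᵇ∧≢ zero    zero    = refl
<ᵇ-as-≤ᵇ∧≢ zero    (suc i) = refl
<ᵇ-as-≤ᵇ∧≢ (suc a) zero    = refl
<ᵇ-as-≤ᵇ∧≢ (suc a) (suc i) =
  trans (<ᵇ-as-≤ᵇ∧≢ a i) (cong (_∧ not (i ≡ᵇ a)) (≤ᵇ-as-<ᵇ a i))

range-tail : ∀ a m i → inRange (suc a) m i ≡ inRange a (suc m) i ∧ not (i ≡ᵇ a)
range-tail a m i = begin
  (a <ᵇ i) ∧ (i <ᵇ suc (a + m))
    ≡⟨ cong₂ _∧_ (<ᵇ-as-≤ᵇ∧≢ a i) (cong (i <ᵇ_) (sym (+-suc a m))) ⟩
  ((a ≤ᵇ i) ∧ not (i ≡ᵇ a)) ∧ (i <ᵇ a + suc m)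
    ≡⟨ swap-last (a ≤ᵇ i) _ _ ⟩
  ((a ≤ᵇ i) ∧ (i <ᵇ a + suc m)) ∧ not (i ≡ᵇ a) ∎
  where
  swap-last : ∀ x y z → (x ∧ y) ∧ z ≡ (x ∧ z) ∧ y
  swap-last true  y z = ∧-comm y z
  swap-last false y z = refl

box : ℕ → ℕ → ℕ → ℕ → CellSet
box a b m n (i , j) = inRange a m i ∧ inRange b n j

box-mk : ∀ a b m n {i j} → a ≤ i → i < a + m → b ≤ j → j < b + n → (i , j) ∈R box a b m n
box-mk a b m n a≤i i<a+m b≤j j<b+n = ∧-intro (inRange-complete a≤i i<a+m) (inRange-complete b≤j j<b+n)

box-rows : ∀ a b m n i j → (i , j) ∈R box a b m n → inRange a m i ≡ true
box-rows a b m n i j = ∧-conicalˡ (inRange a m i) (inRange b n j)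

box-cols : ∀ a b m n i j → (i , j) ∈R box a b m n → inRange b n j ≡ true
box-cols a b m n i j = ∧-conicalʳ (inRange a m i) (inRange b n j)

box-no-rows : ∀ a b n → EmptySet (box a b 0 n)
box-no-rows a b n (i , j) = cong (_∧ _) (empty-range a i)

box-no-cols : ∀ a b m → EmptySet (box a b m 0)
box-no-cols a b m (i , j) = trans (cong (inRange a m i ∧_) (empty-range b j)) (∧-zeroʳ _)

corner-in-box : ∀ a b m n → (a , b) ∈R box a b (suc m) (suc n)
corner-in-box a b m n = ∧-intro (range-start a m) (range-start b n)

box-corner : ∀ a b m n → NWCorner (box a b (suc m) (suc n)) (a , b)
box-corner a b m n = corner-in-box a b m n , above a , left b
  where
  above : ∀ a → AboveNotIn (box a b (suc m) (suc n)) (a , b)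
  above zero    = tt
  above (suc a) = cong (_∧ inRange b (suc n) b) (range-before a (suc m))
  left : ∀ b → LeftNotIn (box a b (suc m) (suc n)) (a , b)
  left zero    = tt
  left (suc b) = trans (cong (inRange a (suc m) a ∧_) (range-before b (suc n))) (∧-zeroʳ _)

box-corner-unique : ∀ a b m n {s} → NWCorner (box a b m n) s → s ≡ (a , b)
box-corner-unique a b m n {i , j} (s∈box , above , left) =
  cong₂ _,_ (range-first i i-in-range (row-before above))
            (range-first j j-in-range (column-before left))
  where
  i-in-range = box-rows a b m n i j s∈box
  j-in-range = box-cols a b m n i j s∈box
  row-before : AboveNotIn (box a b m n) (i , j) → ∀ {i′} → i ≡ suc i′ → inRange a m i′ ≡ false
  row-before above refl =
    trans (sym (trans (cong (inRange a m _ ∧_) j-in-range) (∧-identityʳ _))) above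
  column-before : LeftNotIn (box a b m n) (i , j) → ∀ {j′} → j ≡ suc j′ → inRange b n j′ ≡ false
  column-before left refl = trans (cong (_∧ inRange b n _) (sym i-in-range)) left

run-east : ∀ i j k → run east (i , j) k ≡ (i , j + k)
run-east i j zero    = cong (i ,_) (sym (+-identityʳ j))
run-east i j (suc k) = trans (cong (step east) (run-east i j k)) (cong (i ,_) (sym (+-suc j k)))

run-south : ∀ i j k → run south (i , j) k ≡ (i + k , j)
run-south i j zero    = cong (_, j) (sym (+-identityʳ i))
run-south i j (suc k) = trans (cong (step south) (run-south i j k)) (cong (_, j) (sym (+-suc i k)))

box-east-run : ∀ a b m n → MaximalRun (box a b (suc m) (suc n)) (a , b) east n
box-east-run a b m n =
    (λ k k≤n → subst (_∈R box a b (suc m) (suc n)) (sym (run-east a b k))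
                 (∧-intro (range-start a m) (inRange-complete (m≤m+n b k) (+-monoʳ-< b (s≤s k≤n)))))
  , subst (_∉R box a b (suc m) (suc n)) (sym (run-east a b (suc n)))
      (trans (cong (inRange a (suc m) a ∧_) (range-end b (suc n))) (∧-zeroʳ _))

box-south-run : ∀ a b m n → MaximalRun (box a b (suc m) (suc n)) (a , b) south m
box-south-run a b m n =
    (λ k k≤m → subst (_∈R box a b (suc m) (suc n)) (sym (run-south a b k))
                 (∧-intro (inRange-complete (m≤m+n a k) (+-monoʳ-< a (s≤s k≤m))) (range-start b n)))
  , subst (_∉R box a b (suc m) (suc n)) (sym (run-south a b (suc m)))
      (cong (_∧ inRange b (suc n) b) (range-end a (suc m)))

box-remove-row : ∀ a b m n → remove (box a b (suc m) (suc n)) east (a , b) n ≗ box (suc a) b m (suc n)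
box-remove-row a b m n (i , j) = begin
  (x ∧ y) ∧ not ((i ≡ᵇ a) ∧ ((b ≤ᵇ j) ∧ (j ≤ᵇ b + n)))
    ≡⟨ cong (λ z → (x ∧ y) ∧ not ((i ≡ᵇ a) ∧ z)) (interval-as-range b n j) ⟩
  (x ∧ y) ∧ not ((i ≡ᵇ a) ∧ y)
    ≡⟨ strip x y (i ≡ᵇ a) ⟩
  (x ∧ not (i ≡ᵇ a)) ∧ y
    ≡⟨ cong (_∧ y) (sym (range-tail a m i)) ⟩
  inRange (suc a) m i ∧ y ∎
  where
  x = inRange a (suc m) i
  y = inRange b (suc n) j
  strip : ∀ x y e → (x ∧ y) ∧ not (e ∧ y) ≡ (x ∧ not e) ∧ y
  strip false _     _     = refl
  strip true  true  true  = refl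
  strip true  true  false = refl
  strip true  false true  = refl
  strip true  false false = refl

box-remove-column : ∀ a b m n → remove (box a b (suc m) (suc n)) south (a , b) m ≗ box a (suc b) (suc m) n
box-remove-column a b m n (i , j) = begin
  (x ∧ y) ∧ not ((j ≡ᵇ b) ∧ ((a ≤ᵇ i) ∧ (i ≤ᵇ a + m)))
    ≡⟨ cong (λ z → (x ∧ y) ∧ not ((j ≡ᵇ b) ∧ z)) (interval-as-range a m i) ⟩
  (x ∧ y) ∧ not ((j ≡ᵇ b) ∧ x)
    ≡⟨ strip x y (j ≡ᵇ b) ⟩
  x ∧ (y ∧ not (j ≡ᵇ b))
    ≡⟨ cong (x ∧_) (sym (range-tail b n j)) ⟩
  x ∧ inRange (suc b) n j ∎
  where
  x = inRange a (suc m) i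
  y = inRange b (suc n) j
  strip : ∀ x y e → (x ∧ y) ∧ not (e ∧ x) ≡ x ∧ (y ∧ not e)
  strip false _ _     = refl
  strip true  _ true  = refl
  strip true  _ false = refl

run-path : ∀ {C} dir c k → (∀ t → t ≤ k → run dir c t ∈R C) → Path C c (run dir c k)
run-path dir c zero    inside = here (inside 0 z≤n)
run-path dir c (suc k) inside =
  path-++ (run-path dir c k (λ t t≤k → inside t (m≤n⇒m≤1+n t≤k)))
          (next (inside k (n≤1+n k)) (dir , inj₁ refl) (here (inside (suc k) ≤-refl)))

corner-path : ∀ a b m n x y → x < m → y < n → Path (box a b m n) (a , b) (a + x , b + y)
corner-path a b m n x y x<m y<n =
  path-++ (subst (Path B (a , b)) (run-south a b x) (run-path south (a , b) x down))
          (subst (Path B (a + x , b)) (run-east (a + x) b y) (run-path east (a + x , b) y along))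
  where
  B = box a b m n
  down : ∀ t → t ≤ x → run south (a , b) t ∈R B
  down t t≤x = subst (_∈R B) (sym (run-south a b t))
    (box-mk a b m n (m≤m+n a t) (+-monoʳ-< a (≤-<-trans t≤x x<m)) ≤-refl (m<m+n b (≤-<-trans z≤n y<n)))
  along : ∀ t → t ≤ y → run east (a + x , b) t ∈R B
  along t t≤y = subst (_∈R B) (sym (run-east (a + x) b t))
    (box-mk a b m n (m≤m+n a x) (+-monoʳ-< a x<m) (m≤m+n b t) (+-monoʳ-< b (≤-<-trans t≤y y<n)))

box-connected : ∀ a b m n → Connected (box a b m n)
box-connected a b m n c d c∈box d∈box =
  path-++ (path-reverse (from-corner c c∈box)) (from-corner d d∈box)
  where
  from-corner : ∀ c → c ∈R box a b m n → Path (box a b m n) (a , b) c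
  from-corner (i , j) c∈box =
    let a≤i , i<a+m = inRange-sound a m i (box-rows a b m n i j c∈box)
        b≤j , j<b+n = inRange-sound b n j (box-cols a b m n i j c∈box)
    in  subst₂ (λ i j → Path (box a b m n) (a , b) (i , j)) (m+[n∸m]≡n a≤i) (m+[n∸m]≡n b≤j)
          (corner-path a b m n (i ∸ a) (j ∸ b)
            (+-cancelˡ-< a _ _ (subst (_< a + m) (sym (m+[n∸m]≡n a≤i)) i<a+m))
            (+-cancelˡ-< b _ _ (subst (_< b + n) (sym (m+[n∸m]≡n b≤j)) j<b+n)))

-- In the 1 × 1 box the east and the south spotlight are the same single
-- square; 'unlessUnit' drops the duplicate list of south-first tilings there.
IsUnit : ℕ → ℕ → Set
IsUnit m n = m ≡ 0 × n ≡ 0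

unlessUnit : ∀ {A : Set} → ℕ → ℕ → List A → List A
unlessUnit zero    zero    _  = []
unlessUnit zero    (suc _) xs = xs
unlessUnit (suc _) _       xs = xs

All-unlessUnit : ∀ {A : Set} {P : A → Set} m n {xs} →
                 (¬ IsUnit m n → All P xs) → All P (unlessUnit m n xs)
All-unlessUnit zero    zero    _   = []
All-unlessUnit zero    (suc n) all = all (λ { (_ , ()) })
All-unlessUnit (suc m) n       all = all (λ { (() , _) })

AllPairs-unlessUnit : ∀ {A : Set} {R : A → A → Set} m n {xs} →
                      AllPairs R xs → AllPairs R (unlessUnit m n xs)
AllPairs-unlessUnit zero    zero    _     = []
AllPairs-unlessUnit zero    (suc n) pairs = pairs
AllPairs-unlessUnit (suc m) n       pairs = pairs

mutual
  tilings : ℕ → ℕ → ℕ → ℕ → List (List Spotlight)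
  tilings a b zero    n       = [] ∷ []
  tilings a b (suc m) zero    = [] ∷ []
  tilings a b (suc m) (suc n) = eastFirst a b m n ++ unlessUnit m n (southFirst a b m n)

  eastFirst : ℕ → ℕ → ℕ → ℕ → List (List Spotlight)
  eastFirst a b m n = map (mkSpot east (a , b) n ∷_) (tilings (suc a) b m (suc n))

  southFirst : ℕ → ℕ → ℕ → ℕ → List (List Spotlight)
  southFirst a b m n = map (mkSpot south (a , b) m ∷_) (tilings a (suc b) (suc m) n)

place-row : ∀ a b m n {T} → Tiling (box (suc a) b m (suc n)) T →
            Tiling (box a b (suc m) (suc n)) (mkSpot east (a , b) n ∷ T)
place-row a b m n =
  place-onto (box a b (suc m) (suc n)) (a , b) east n (box-corner a b m n) (box-east-run a b m n)
             (box-remove-row a b m n) (box-connected (suc a) b m (suc n))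

place-column : ∀ a b m n {T} → Tiling (box a (suc b) (suc m) n) T →
               Tiling (box a b (suc m) (suc n)) (mkSpot south (a , b) m ∷ T)
place-column a b m n =
  place-onto (box a b (suc m) (suc n)) (a , b) south m (box-corner a b m n) (box-south-run a b m n)
             (box-remove-column a b m n) (box-connected a (suc b) (suc m) n)

below-row : ∀ a b m n {Cs T} → IsComponents (remove (box a b (suc m) (suc n)) east (a , b) n) Cs →
            Tilings Cs T → Tiling (box (suc a) b m (suc n)) T
below-row a b m n =
  remainder-tiling (box a b (suc m) (suc n)) (a , b) east n
                   (box-remove-row a b m n) (box-connected (suc a) b m (suc n))

right-of-column : ∀ a b m n {Cs T} → IsComponents (remove (box a b (suc m) (suc n)) south (a , b) m) Cs →
                  Tilings Cs T → Tiling (box a (suc b) (suc m) n) T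
right-of-column a b m n =
  remainder-tiling (box a b (suc m) (suc n)) (a , b) south m
                   (box-remove-column a b m n) (box-connected a (suc b) (suc m) n)

tilings-sound : ∀ a b m n → All (Tiling (box a b m n)) (tilings a b m n)
tilings-sound a b zero    n       = empty (box-no-rows a b n) ∷ []
tilings-sound a b (suc m) zero    = empty (box-no-cols a b (suc m)) ∷ []
tilings-sound a b (suc m) (suc n) =
  AllP.++⁺ (AllP.map⁺ (All.map (place-row a b m n) (tilings-sound (suc a) b m (suc n))))
           (All-unlessUnit m n λ _ →
              AllP.map⁺ (All.map (place-column a b m n) (tilings-sound a (suc b) (suc m) n)))

-- A south-first tiling is listed: in the 1 × 1 box it is the east-first one.
south-first-listed : ∀ a b m n {T} → T ∈ tilings a (suc b) (suc m) n →
                     (mkSpot south (a , b) m ∷ T) ∈ tilings a b (suc m) (suc n)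
south-first-listed a b zero    zero    (here refl) = here refl
south-first-listed a b zero    (suc n) T∈          = ∈-++⁺ʳ (eastFirst a b 0 (suc n)) (∈-map⁺ _ T∈)
south-first-listed a b (suc m) n       T∈          = ∈-++⁺ʳ (eastFirst a b (suc m) n) (∈-map⁺ _ T∈)

-- Every tiling of the box is listed: its first spotlight sits at the unique
-- northwest corner and is the top row or the left column, and the rest tiles
-- the remaining box.
tilings-complete : ∀ a b m n {T} → Tiling (box a b m n) T → T ∈ tilings a b m n
tilings-complete a b zero    n       t = here (tiling-of-empty (box-no-rows a b n) t)
tilings-complete a b (suc m) zero    t = here (tiling-of-empty (box-no-cols a b (suc m)) t)
tilings-complete a b (suc m) (suc n) (empty box-empty) =
  contradiction (corner-in-box a b m n) (not-¬ (box-empty (a , b)))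
tilings-complete a b (suc m) (suc n) (place {dir = east} nw run cs ts)
  with refl ← box-corner-unique a b (suc m) (suc n) nw
  with refl ← maximal-run-unique (box a b (suc m) (suc n)) (a , b) east run (box-east-run a b m n) =
  ∈-++⁺ˡ (∈-map⁺ _ (tilings-complete (suc a) b m (suc n) (below-row a b m n cs ts)))
tilings-complete a b (suc m) (suc n) (place {dir = south} nw run cs ts)
  with refl ← box-corner-unique a b (suc m) (suc n) nw
  with refl ← maximal-run-unique (box a b (suc m) (suc n)) (a , b) south run (box-south-run a b m n) =
  south-first-listed a b m n (tilings-complete a (suc b) (suc m) n (right-of-column a b m n cs ts))

-- Tilings are compared as collections of spotlights, i.e. up to reordering.
Distinct : List Spotlight → List Spotlight → Set
Distinct T U = ¬ (T ↭ U)

prefix-distinct : ∀ x {L} → AllPairs Distinct L → AllPairs Distinct (map (x ∷_) L)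
prefix-distinct x pairs =
  AllPairsP.map⁺ (AllPairs.map (λ T≠U x∷T↭x∷U → T≠U (drop-mid [] [] x∷T↭x∷U)) pairs)

east≢south : ∀ s m n → ¬ IsUnit m n → mkSpot east s n ≢ mkSpot south s m
east≢south s zero    zero    non-unit _  = non-unit (refl , refl)
east≢south s zero    (suc n) _        ()
east≢south s (suc m) zero    _        ()
east≢south s (suc m) (suc n) _        ()

-- No south-first tiling contains the east spotlight of the corner: its own
-- first spotlight is different, and all others start right of column b.
east-not-south-first : ∀ a b m n → All (mkSpot east (a , b) n ∉_) (unlessUnit m n (southFirst a b m n))
east-not-south-first a b m n = All-unlessUnit m n λ non-unit →
  AllP.map⁺ (All.map (not-in non-unit) (tilings-sound a (suc b) (suc m) n))
  where
  corner-outside : (a , b) ∉R box a (suc b) (suc m) n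
  corner-outside = trans (cong (inRange a (suc m) a ∧_) (range-before b n)) (∧-zeroʳ _)
  not-in : ¬ IsUnit m n → ∀ {U} → Tiling (box a (suc b) (suc m) n) U →
           mkSpot east (a , b) n ∉ (mkSpot south (a , b) m ∷ U)
  not-in non-unit t (here E≡S)  = east≢south (a , b) m n non-unit E≡S
  not-in non-unit t (there E∈U) =
    not-¬ corner-outside (subst (_∈R box a (suc b) (suc m) n) (endpoint-mkSpot east (a , b) n)
                                (All.lookup (endpoints-inside t) E∈U))

tilings-distinct : ∀ a b m n → AllPairs Distinct (tilings a b m n)
tilings-distinct a b zero    n       = [] ∷ []
tilings-distinct a b (suc m) zero    = [] ∷ []
tilings-distinct a b (suc m) (suc n) =
  AllPairsP.++⁺ (prefix-distinct _ (tilings-distinct (suc a) b m (suc n)))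
                (AllPairs-unlessUnit m n (prefix-distinct _ (tilings-distinct a (suc b) (suc m) n)))
                (AllP.map⁺ (All.universal (λ _ → All.map apart (east-not-south-first a b m n)) _))
  where
  apart : ∀ {T U} → mkSpot east (a , b) n ∉ U → Distinct (mkSpot east (a , b) n ∷ T) U
  apart E∉U E∷T↭U = E∉U (∈-resp-↭ E∷T↭U (here refl))

spotlights : List (List Spotlight) → ℕ
spotlights L = sum (map length L)

spotlights-prefix : ∀ x L → spotlights (map (x ∷_) L) ≡ length L + spotlights L
spotlights-prefix x []      = refl
spotlights-prefix x (T ∷ L) =
  cong suc (trans (cong (length T +_) (spotlights-prefix x L)) (x∙yz≈y∙xz (length T) (length L) _))

length-branches : ∀ x y (xs ys : List (List Spotlight)) →
                  length (map (x ∷_) xs ++ map (y ∷_) ys) ≡ length xs + length ys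
length-branches x y xs ys =
  trans (length-++ (map (x ∷_) xs)) (cong₂ _+_ (length-map (x ∷_) xs) (length-map (y ∷_) ys))

spotlights-branches : ∀ x y xs ys → spotlights (map (x ∷_) xs ++ map (y ∷_) ys)
                                    ≡ (length xs + spotlights xs) + (length ys + spotlights ys)
spotlights-branches x y xs ys = begin
  sum (map length (map (x ∷_) xs ++ map (y ∷_) ys))
    ≡⟨ cong sum (map-++ length (map (x ∷_) xs) _) ⟩
  sum (map length (map (x ∷_) xs) ++ map length (map (y ∷_) ys))
    ≡⟨ sum-++ (map length (map (x ∷_) xs)) _ ⟩
  spotlights (map (x ∷_) xs) + spotlights (map (y ∷_) ys)
    ≡⟨ cong₂ _+_ (spotlights-prefix x xs) (spotlights-prefix y ys) ⟩
  (length xs + spotlights xs) + (length ys + spotlights ys) ∎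

count-tilings : ∀ a b p q → length (tilings a b (suc p) (suc q)) + paths p q ≡ paths (suc p) (suc q)
count-tilings a b zero    zero    = refl
count-tilings a b zero    (suc q) =
  trans (cong (_+ 1) (length-branches (mkSpot east (a , b) (suc q)) (mkSpot south (a , b) 0)
                                      (tilings (suc a) b 0 (2 + q)) south-list))
        (cong suc (count-tilings a (suc b) 0 q))
  where
  south-list = tilings a (suc b) 1 (suc q)
count-tilings a b (suc p) zero    =
  trans (cong (_+ 1) (length-branches (mkSpot east (a , b) 0) (mkSpot south (a , b) (suc p))
                                      east-list (tilings a (suc b) (2 + p) 0)))
        (cong (_+ 1) (trans (cong (length east-list +_) (sym (paths-zero p))) (count-tilings (suc a) b p 0)))
  where
  east-list = tilings (suc a) b (suc p) 1
count-tilings a b (suc p) (suc q) = begin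
  length (eastFirst a b (suc p) (suc q) ++ southFirst a b (suc p) (suc q)) + (paths p (suc q) + paths (suc p) q)
    ≡⟨ cong (_+ _) (length-branches (mkSpot east (a , b) (suc q)) (mkSpot south (a , b) (suc p))
                                    east-list south-list) ⟩
  (length east-list + length south-list) + (paths p (suc q) + paths (suc p) q)
    ≡⟨ interchange (length east-list) (length south-list) (paths p (suc q)) (paths (suc p) q) ⟩
  (length east-list + paths p (suc q)) + (length south-list + paths (suc p) q)
    ≡⟨ cong₂ _+_ (count-tilings (suc a) b p (suc q)) (count-tilings a (suc b) (suc p) q) ⟩
  paths (suc p) (2 + q) + paths (2 + p) (suc q) ∎
  where
  east-list  = tilings (suc a) b (suc p) (2 + q)
  south-list = tilings a (suc b) (2 + p) (suc q)

count-spotlights : ∀ a b p q →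
  spotlights (tilings a b (suc p) (suc q)) + (suc (p + q) * paths p q + paths (2 + p) (2 + q))
  ≡ (4 + p + q) * paths (suc p) (suc q)
count-spotlights a b zero    zero    = refl
count-spotlights a b zero    (suc q) =
  trans (cong (_+ (suc (suc q) * 1 + paths 2 (3 + q)))
              (spotlights-branches (mkSpot east (a , b) (suc q)) (mkSpot south (a , b) 0)
                                   (tilings (suc a) b 0 (2 + q)) south-list))
        (spotlights-row-step q (length south-list) (spotlights south-list) (paths 1 (suc q)) (paths 2 (2 + q))
           (paths-row (suc q)) (count-tilings a (suc b) 0 q) (count-spotlights a (suc b) 0 q))
  where
  south-list = tilings a (suc b) 1 (suc q)
count-spotlights a b (suc p) zero    =
  trans (cong (_+ (suc (suc p + 0) * 1 + paths (3 + p) 2))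
              (spotlights-branches (mkSpot east (a , b) 0) (mkSpot south (a , b) (suc p))
                                   east-list (tilings a (suc b) (2 + p) 0)))
        (spotlights-column-step p (length east-list) (spotlights east-list)
           (paths (suc p) 1) (paths (2 + p) 2) (paths p 0) (paths-zero p) (paths-column (suc p))
           (count-tilings (suc a) b p 0) (count-spotlights (suc a) b p 0))
  where
  east-list = tilings (suc a) b (suc p) 1
count-spotlights a b (suc p) (suc q) =
  trans (cong (_+ (suc (suc p + suc q) * paths (suc p) (suc q) + paths (3 + p) (3 + q)))
              (spotlights-branches (mkSpot east (a , b) (suc q)) (mkSpot south (a , b) (suc p))
                                   east-list south-list))
        (spotlights-interior-step p q
           (length east-list) (spotlights east-list) (length south-list) (spotlights south-list)
           (paths p (suc q)) (paths (suc p) q) (paths (suc p) (2 + q)) (paths (2 + p) (suc q))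
           (paths (2 + p) (3 + q)) (paths (3 + p) (2 + q))
           (count-tilings (suc a) b p (suc q)) (count-spotlights (suc a) b p (suc q))
           (count-tilings a (suc b) (suc p) q) (count-spotlights a (suc b) (suc p) q))
  where
  east-list  = tilings (suc a) b (suc p) (2 + q)
  south-list = tilings a (suc b) (2 + p) (suc q)

tilings-nonempty : ∀ a b m n → 1 ≤ length (tilings a b m n)
tilings-nonempty a b zero    n       = ≤-refl
tilings-nonempty a b (suc m) zero    = ≤-refl
tilings-nonempty a b (suc m) (suc n) =
  ≤-trans (tilings-nonempty (suc a) b m (suc n))
          (subst₂ _≤_ (length-map _ (tilings (suc a) b m (suc n))) (sym (length-++ (eastFirst a b m n)))
                  (m≤m+n _ _))

corollary3p8 : (m n : ℕ) → 1 ≤ m → 1 ≤ n →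
    Σ (List (List Spotlight)) (λ L →
        All (Tiling (rect m n)) L
      × (∀ T → Tiling (rect m n) T → Any (λ U → T ↭ U) L)
      × AllPairs (λ T U → ¬ (T ↭ U)) L
      × 1 ≤ length L
      × sum (map length L) * (((m + n) * (m + n ∸ 1) ∸ m * n) * ((m + 1) * (n + 1)))
        ≡ length L * ((m * n * (m + n ∸ 1))
                      * ((m + 1) * (n + 1) + (n ∸ 1) * (n + 1) + (m ∸ 1) * (m + 1))))
corollary3p8 (suc p) (suc q) (s≤s z≤n) (s≤s z≤n) =
    L
  , tilings-sound 0 0 (suc p) (suc q)
  , (λ T t → Any.map ↭-reflexive (tilings-complete 0 0 (suc p) (suc q) t))
  , tilings-distinct 0 0 (suc p) (suc q)
  , tilings-nonempty 0 0 (suc p) (suc q)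
  , average-identity p q (length L) (spotlights L) (paths p q) (denominator p q) (bracket p q)
      (tilings-ratio p q (length L) (paths p q) (paths (suc p) (suc q))
        (count-tilings 0 0 p q) (paths-diagonal p q))
      (spotlights-ratio p q (spotlights L) (paths p q) (paths (suc p) (suc q)) (paths (2 + p) (2 + q))
        (count-spotlights 0 0 p q) (paths-diagonal p q) (paths-diagonal (suc p) (suc q)))
  where
  L = tilings 0 0 (suc p) (suc q)
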